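{- Fix positive integers $k\leq n$, and let $(i,j)$ satisfy $1\leq i<j\leq n$. Let $(\lambda,\varrho)\in\Theta(\mathsf{Broom}_{k,n}^\times)$. If $j\leq k$, then $(i,j)\in\mathrm{Inv}(\Omega(\lambda,\varrho))$ if and only if $(n+1-j,n+1-i)\in\mathrm{Inv}(\lambda)$. If $j\geq k+1$, then $(i,j)\in\mathrm{Inv}(\Omega(\lambda,\varrho))$ if and only if $n+1-i\in\varrho(n+1-j)$.
   Context: $\mathsf{Broom}_{k,n}$ is the rooted plane tree with vertices $0,1,\ldots,n$ in which vertex $i$ is the child of $i-1$ for $1\leq i\leq n-k$ and vertices $n-k+1,\ldots,n$ are the children of $n-k$ (so $0,1,\ldots,n$ is its preorder traversal); it is viewed as a poset $\leq$ with root $0$ as minimum and each non-root vertex covering its parent. $\mathsf{Broom}_{k,n}^\times$ is the forest poset on $[n]$ obtained by deleting $0$. An ornament is a subset of $[n]$ inducing a connected subgraph of $\mathsf{Broom}_{k,n}^\times$, hung at its minimal element; an ornamentation is a function $\varrho$ from $[n]$ to ornaments with $\varrho(v)$ hung at $v$ and any two values nested or disjoint. A linear extension is a permutation $\lambda$ of $[n]$ (one-line notation) in which $x<y$ in the tree order implies $x$ precedes $y$. $\Theta(\mathsf{Broom}_{k,n}^\times)$ is the set of pairs $(\lambda,\varrho)$ of a linear extension and an ornamentation such that each $\varrho(v)$ occupies consecutive positions of $\lambda$. An inversion of a permutation $w$ of $[n]$ is a pair $(i,j)$ with $i<j$ and $j$ appearing before $i$; $\mathrm{Inv}(w)$ is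 the set of them. For $(\lambda,\varrho)\in\Theta(\mathsf{Broom}_{k,n}^\times)$ with $\lambda=w_1\cdots w_n$: for $u\in[n]$ let $A_\varrho(u)=\{j\in[n]: u\in\varrho(n+1-j)\}$; let $B_{(\lambda,\varrho)}(w_\ell)=A_\varrho(w_\ell)\setminus\bigcup_{i=\ell+1}^n A_\varrho(w_i)$; let $\mu_{(\lambda,\varrho)}(w_\ell)$ be the word listing the elements of $B_{(\lambda,\varrho)}(w_\ell)$ in decreasing order; and $\Omega(\lambda,\varrho)=\mu_{(\lambda,\varrho)}(w_n)\mu_{(\lambda,\varrho)}(w_{n-1})\cdots\mu_{(\lambda,\varrho)}(w_1)$, a permutation in $\mathfrak S_n$. -}

module Defs where

open import Data.Nat using (ℕ; zero; suc; _+_; _∸_; _≤_; _<_)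
open import Data.Bool using (Bool; true; false; _∧_; not; T)
open import Data.List using (List; []; _∷_; _++_; filter; map; applyUpTo; downFrom)
open import Data.Bool.ListAction using (any)
open import Data.List.Relation.Binary.Permutation.Propositional using (_↭_)
open import Data.Product using (Σ; _×_; _,_)
open import Data.Sum using (_⊎_)
open import Data.Empty using (⊥)
open import Relation.Binary.PropositionalEquality using (_≡_; _≢_)
open import Relation.Binary.Construct.Closure.ReflexiveTransitive using (Star)
open import Function.Bundles using (_⇔_)

[1‥_] : ℕ → List ℕ
[1‥ n ] = applyUpTo suc n

[_‥1] : ℕ → List ℕ
[ n ‥1] = map suc (downFrom n)

-- Parent k n p c : vertex c ∈ [n] covers vertex p ∈ [n] (p is the parent
-- of c in Broom_{k,n}, and p ≠ 0 since the root 0 is deleted).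
Parent : ℕ → ℕ → ℕ → ℕ → Set
Parent k n p c = (1 ≤ p) × (c ≤ n) ×
  (((c ≤ n ∸ k) × (suc p ≡ c)) ⊎ ((n ∸ k < c) × (p ≡ n ∸ k)))

_⊢_≼_ : ℕ × ℕ → ℕ → ℕ → Set
(k , n) ⊢ x ≼ y = Star (Parent k n) x y

_⊢_≺_ : ℕ × ℕ → ℕ → ℕ → Set
kn ⊢ x ≺ y = (kn ⊢ x ≼ y) × (x ≢ y)

Edge : ℕ → ℕ → ℕ → ℕ → Set
Edge k n x y = Parent k n x y ⊎ Parent k n y x

Subset : Set
Subset = ℕ → Bool

_∈ₛ_ : ℕ → Subset → Set
u ∈ₛ S = T (S u)

_⊆ₛ_ : Subset → Subset → Set
S ⊆ₛ S' = ∀ u → u ∈ₛ S → u ∈ₛ S'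

Disjoint : Subset → Subset → Set
Disjoint S S' = ∀ u → u ∈ₛ S → u ∈ₛ S' → ⊥

InducedEdge : ℕ → ℕ → Subset → ℕ → ℕ → Set
InducedEdge k n S x y = (x ∈ₛ S) × (y ∈ₛ S) × Edge k n x y

Connected : ℕ → ℕ → Subset → Set
Connected k n S = ∀ x y → x ∈ₛ S → y ∈ₛ S → Star (InducedEdge k n S) x y

OrnamentAt : ℕ → ℕ → Subset → ℕ → Set
OrnamentAt k n S v =
  (∀ u → u ∈ₛ S → (1 ≤ u) × (u ≤ n)) ×
  Connected k n S ×
  (v ∈ₛ S) ×
  (∀ u → u ∈ₛ S → (k , n) ⊢ v ≼ u)

-- ornamentation: ϱ v is the ornament ϱ(v) (only v ∈ [n] matters)
Ornamentation : ℕ → ℕ → (ℕ → Subset) → Set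
Ornamentation k n ϱ =
  (∀ v → 1 ≤ v → v ≤ n → OrnamentAt k n (ϱ v) v) ×
  (∀ v w → 1 ≤ v → v ≤ n → 1 ≤ w → w ≤ n →
     (ϱ v ⊆ₛ ϱ w) ⊎ (ϱ w ⊆ₛ ϱ v) ⊎ Disjoint (ϱ v) (ϱ w))

Precedes : List ℕ → ℕ → ℕ → Set
Precedes w x y = Σ (List ℕ) λ as → Σ (List ℕ) λ bs → Σ (List ℕ) λ cs →
  w ≡ as ++ x ∷ bs ++ y ∷ cs

Inv : List ℕ → ℕ → ℕ → Set
Inv w i j = (i < j) × Precedes w j i

LinearExtension : ℕ → ℕ → List ℕ → Set
LinearExtension k n lam =
  (lam ↭ [1‥ n ]) × (∀ x y → (k , n) ⊢ x ≺ y → Precedes lam x y)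

Consecutive : List ℕ → Subset → Set
Consecutive w S = Σ (List ℕ) λ pre → Σ (List ℕ) λ mid → Σ (List ℕ) λ post →
  (w ≡ pre ++ mid ++ post) ×
  (∀ u → (u ∈ₛ S) ⇔ (Data.List.Membership.Propositional._∈_ u mid))
  where import Data.List.Membership.Propositional

InΘ : ℕ → ℕ → List ℕ → (ℕ → Subset) → Set
InΘ k n lam ϱ = LinearExtension k n lam × Ornamentation k n ϱ ×
  (∀ v → 1 ≤ v → v ≤ n → Consecutive lam (ϱ v))

-- The map Ω.
-- j ∈ A_ϱ(u)  iff  u ∈ ϱ(n+1-j)   (for j ∈ [n])
inA : ℕ → (ℕ → Subset) → ℕ → ℕ → Bool
inA n ϱ u j = ϱ (suc n ∸ j) u

-- μ(w_ℓ), given w_ℓ and the later letters w_{ℓ+1} … w_n :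
-- elements of B(w_ℓ) = A(w_ℓ) ∖ ⋃_{later} A(w_i), in decreasing order
μ : ℕ → (ℕ → Subset) → ℕ → List ℕ → List ℕ
μ n ϱ w later =
  filter (λ j → T? (inA n ϱ w j ∧ not (any (λ w' → inA n ϱ w' j) later))) [ n ‥1]
  where open import Relation.Nullary.Decidable using () renaming (T? to T?)

Ωaux : ℕ → (ℕ → Subset) → List ℕ → List ℕ
Ωaux n ϱ [] = []
Ωaux n ϱ (w ∷ later) = Ωaux n ϱ later ++ μ n ϱ w later

Ω : ℕ → List ℕ → (ℕ → Subset) → List ℕ
Ω n lam ϱ = Ωaux n ϱ lam

-- Call the host of j ∈ [n] the last letter of λ lying in ϱ(n+1-j).  By construction
-- j is listed in Ω inside the block μ(host of j); the blocks occur in the reverse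
-- order of λ and each block is decreasing.  Hence, for i < j, j precedes i in Ω iff
-- no letter after the host of j lies in ϱ(n+1-i).  Put a = n+1-j < b = n+1-i.
-- If j ≤ k then a and b are leaves of the broom, so ϱ(a) = {a}, ϱ(b) = {b}, and the
-- condition says that b comes before a in λ.  If j > k then a lies on the handle
-- below b.  When b ∈ ϱ(a) the ornaments are nested, ϱ(b) ⊆ ϱ(a), and the condition
-- holds because the host of j is the last letter in ϱ(a).  Conversely, if the
-- condition holds then b is not after the host of j; being after a in λ, it lies
-- between two letters of the consecutive block ϱ(a), so b ∈ ϱ(a).

module Submission where

open import Defs
open import Data.Nat using (ℕ; suc; z≤n; _+_; _∸_; _≤_; _<_; _≤′_; ≤′-reflexive; ≤′-step; s≤s)
open import Data.Nat.Properties
open import Data.Bool using (Bool; true; false; T; _∧_; not)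
open import Data.Bool.Properties using (T-∧; T-not-≡)
open import Data.Bool.ListAction using (any)
open import Data.List using (List; []; _∷_; _++_; filter)
open import Data.List.Membership.Propositional using (_∈_; _∉_; lose; find)
open import Data.List.Membership.Propositional.Properties
  using (∈-++⁺ˡ; ∈-++⁺ʳ; ∈-++⁻; ∈-∃++; ∈-filter⁺; ∈-filter⁻; ∈-map⁺; ∈-map⁻; ∈-downFrom⁺; ∈-downFrom⁻; ∈-applyUpTo⁺)
open import Data.List.Relation.Unary.Any as Any using (Any; here; there)
open import Data.List.Relation.Unary.Any.Properties using (any⁺; any⁻)
open import Data.List.Relation.Unary.AllPairs using (_∷_)
open import Data.List.Relation.Unary.Unique.Propositional using (Unique)
open import Data.List.Relation.Unary.Unique.Propositional.Properties using (Unique[x∷xs]⇒x∉xs; applyUpTo⁺₁)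
open import Data.List.Relation.Binary.Permutation.Propositional using (↭-sym; ↭⇒↭ₛ)
open import Data.List.Relation.Binary.Permutation.Propositional.Properties using (∈-resp-↭)
open import Data.List.Relation.Binary.Permutation.Setoid.Properties using (Unique-resp-↭)
open import Data.Product using (∃₂; _×_; _,_; proj₁; proj₂)
open import Data.Sum using (_⊎_; inj₁; inj₂)
open import Data.Empty using (⊥; ⊥-elim)
open import Data.Unit using (tt)
open import Function using (_∘_)
open import Function.Bundles using (_⇔_; mk⇔; Equivalence)
import Function.Properties.Equivalence as ⇔
open import Relation.Binary.PropositionalEquality
open import Relation.Binary.Construct.Closure.ReflexiveTransitive using (ε; _◅_; _◅◅_)
open import Relation.Nullary using (¬_; yes; no; does)
open import Relation.Nullary.Decidable using (T?)
open import Relation.Unary using (Pred; Decidable)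

private variable
  A : Set
  x y z : A
  xs ys : List A

Before : List A → A → A → Set
Before []       x y = ⊥
Before (z ∷ zs) x y = (z ≡ x × y ∈ zs) ⊎ Before zs x y

Precedes⇒Before : ∀ {w : List ℕ} {x y} → Precedes w x y → Before w x y
Precedes⇒Before ([]     , bs , cs , refl) = inj₁ (refl , ∈-++⁺ʳ bs (here refl))
Precedes⇒Before (a ∷ as , bs , cs , refl) = inj₂ (Precedes⇒Before (as , bs , cs , refl))

Before⇒Precedes : ∀ (w : List ℕ) {x y} → Before w x y → Precedes w x y
Before⇒Precedes (z ∷ zs) (inj₁ (refl , y∈zs)) with bs , cs , refl ← ∈-∃++ y∈zs = [] , bs , cs , refl
Before⇒Precedes (z ∷ zs) (inj₂ p) with as , bs , cs , refl ← Before⇒Precedes zs p = z ∷ as , bs , cs , refl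

Before-∈ : Before xs x y → x ∈ xs × y ∈ xs
Before-∈ {xs = z ∷ zs} (inj₁ (refl , y∈)) = here refl , there y∈
Before-∈ {xs = z ∷ zs} (inj₂ p) with x∈ , y∈ ← Before-∈ p = there x∈ , there y∈

Before-++⁺ˡ : ∀ xs → Before xs x y → Before (xs ++ ys) x y
Before-++⁺ˡ (z ∷ zs) (inj₁ (refl , y∈)) = inj₁ (refl , ∈-++⁺ˡ y∈)
Before-++⁺ˡ (z ∷ zs) (inj₂ p)           = inj₂ (Before-++⁺ˡ zs p)

Before-++⁺ʳ : ∀ xs → Before ys x y → Before (xs ++ ys) x y
Before-++⁺ʳ []       p = p
Before-++⁺ʳ (z ∷ zs) p = inj₂ (Before-++⁺ʳ zs p)

Before-++⁺ : ∀ xs → x ∈ xs → y ∈ ys → Before (xs ++ ys) x y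
Before-++⁺ (z ∷ zs) (here refl) y∈ = inj₁ (refl , ∈-++⁺ʳ zs y∈)
Before-++⁺ (z ∷ zs) (there x∈)  y∈ = inj₂ (Before-++⁺ zs x∈ y∈)

Before-++⁻ : ∀ xs → Before (xs ++ ys) x y →
             Before xs x y ⊎ (x ∈ xs × y ∈ ys) ⊎ Before ys x y
Before-++⁻ []       p = inj₂ (inj₂ p)
Before-++⁻ (z ∷ zs) (inj₁ (refl , y∈)) with ∈-++⁻ zs y∈
... | inj₁ y∈zs = inj₁ (inj₁ (refl , y∈zs))
... | inj₂ y∈ys = inj₂ (inj₁ (here refl , y∈ys))
Before-++⁻ (z ∷ zs) (inj₂ p) with Before-++⁻ zs p
... | inj₁ q                = inj₁ (inj₂ q)
... | inj₂ (inj₁ (x∈ , y∈)) = inj₂ (inj₁ (there x∈ , y∈))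
... | inj₂ (inj₂ q)         = inj₂ (inj₂ q)

Before-filter⁺ : ∀ {p} {P : Pred A p} (P? : Decidable P) xs →
                 Before xs x y → P x → P y → Before (filter P? xs) x y
Before-filter⁺ P? (z ∷ zs) (inj₁ (refl , y∈)) px py with P? z
... | yes _  = inj₁ (refl , ∈-filter⁺ P? y∈ py)
... | no ¬pz = ⊥-elim (¬pz px)
Before-filter⁺ P? (z ∷ zs) (inj₂ p) px py with does (P? z)
... | true  = inj₂ (Before-filter⁺ P? zs p px py)
... | false = Before-filter⁺ P? zs p px py

Unique-++-disjoint : ∀ xs → Unique (xs ++ ys) → x ∈ xs → x ∉ ys
Unique-++-disjoint (z ∷ zs) u       (here refl) x∈ys = Unique[x∷xs]⇒x∉xs u (∈-++⁺ʳ zs x∈ys)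
Unique-++-disjoint (z ∷ zs) (_ ∷ u) (there x∈)  x∈ys = Unique-++-disjoint zs u x∈ x∈ys

Before-asym : Unique xs → Before xs x y → ¬ Before xs y x
Before-asym {xs = z ∷ zs} u       (inj₁ (refl , y∈)) (inj₁ (refl , _)) = Unique[x∷xs]⇒x∉xs u y∈
Before-asym {xs = z ∷ zs} u       (inj₁ (refl , _))  (inj₂ q)          = Unique[x∷xs]⇒x∉xs u (proj₂ (Before-∈ q))
Before-asym {xs = z ∷ zs} u       (inj₂ p)           (inj₁ (refl , _)) = Unique[x∷xs]⇒x∉xs u (proj₂ (Before-∈ p))
Before-asym {xs = z ∷ zs} (_ ∷ u) (inj₂ p)           (inj₂ q)          = Before-asym u p q

Before-++-suffix : ∀ xs → Unique (xs ++ ys) → Before (xs ++ ys) x y → x ∈ ys → y ∈ ys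
Before-++-suffix xs u p x∈ys with Before-++⁻ xs p
... | inj₁ q               = ⊥-elim (Unique-++-disjoint xs u (proj₁ (Before-∈ q)) x∈ys)
... | inj₂ (inj₁ (x∈ , _)) = ⊥-elim (Unique-++-disjoint xs u x∈ x∈ys)
... | inj₂ (inj₂ q)        = proj₂ (Before-∈ q)

Before-convex : ∀ {a b c : A} xs ps ms qs → xs ≡ ps ++ ms ++ qs → Unique xs →
                Before xs a b → Before xs b c → a ∈ ms → c ∈ ms → b ∈ ms
Before-convex _ ps ms qs refl u ab bc a∈ c∈ with ∈-++⁻ ms (Before-++-suffix ps u ab (∈-++⁺ˡ a∈))
... | inj₁ b∈ms = b∈ms
... | inj₂ b∈qs = ⊥-elim (Before-asym u bc (Before-++⁺ʳ ps (Before-++⁺ ms c∈ b∈qs)))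

T-not-any⁺ : ∀ (f : A → Bool) xs → ¬ Any (T ∘ f) xs → T (not (any f xs))
T-not-any⁺ f xs ¬p with any f xs in eq
... | true  = ¬p (any⁻ f xs (subst T (sym eq) tt))
... | false = tt

T-not-any⁻ : ∀ {f : A → Bool} {xs} → T (not (any f xs)) → ¬ Any (T ∘ f) xs
T-not-any⁻ {f = f} none p = subst T (Equivalence.to T-not-≡ none) (any⁺ f p)

data IsLast (f : A → Bool) (y : A) (ys : List A) : List A → Set where
  last : T (f y) → T (not (any f ys)) → IsLast f y ys (y ∷ ys)
  skip : IsLast f y ys xs → IsLast f y ys (x ∷ xs)

module _ {f : A → Bool} where

  IsLast⇒∈ : IsLast f y ys xs → y ∈ xs
  IsLast⇒∈ (last _ _) = here refl
  IsLast⇒∈ (skip l)   = there (IsLast⇒∈ l)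

  IsLast⇒T : IsLast f y ys xs → T (f y)
  IsLast⇒T (last fy _) = fy
  IsLast⇒T (skip l)    = IsLast⇒T l

  IsLast⇒none : IsLast f y ys xs → T (not (any f ys))
  IsLast⇒none (last _ none) = none
  IsLast⇒none (skip l)      = IsLast⇒none l

  IsLast-suffix : ∀ {p} {P : Pred A p} → IsLast f y ys xs → Any P ys → Any P xs
  IsLast-suffix (last _ _) p = there p
  IsLast-suffix (skip l)   p = there (IsLast-suffix l p)

  IsLast-Before : IsLast f y ys xs → z ∈ ys → Before xs y z
  IsLast-Before (last _ _) z∈ = inj₁ (refl , z∈)
  IsLast-Before (skip l)   z∈ = inj₂ (IsLast-Before l z∈)

  IsLast-∈ : IsLast f y ys xs → z ∈ xs → Before xs z y ⊎ z ≡ y ⊎ z ∈ ys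
  IsLast-∈ (last _ _) (here refl) = inj₂ (inj₁ refl)
  IsLast-∈ (last _ _) (there z∈)  = inj₂ (inj₂ z∈)
  IsLast-∈ (skip l)   (here refl) = inj₁ (inj₁ (refl , IsLast⇒∈ l))
  IsLast-∈ (skip l)   (there z∈)  with IsLast-∈ l z∈
  ... | inj₁ p = inj₁ (inj₂ p)
  ... | inj₂ q = inj₂ q

  IsLast-unique : ∀ {y′ ys′} → IsLast f y ys xs → IsLast f y′ ys′ xs → ys ≡ ys′
  IsLast-unique (last _ _)    (last _ _)    = refl
  IsLast-unique (last _ none) (skip l)      = ⊥-elim (T-not-any⁻ none (lose (IsLast⇒∈ l) (IsLast⇒T l)))
  IsLast-unique (skip l)      (last _ none) = ⊥-elim (T-not-any⁻ none (lose (IsLast⇒∈ l) (IsLast⇒T l)))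
  IsLast-unique (skip l)      (skip l′)     = IsLast-unique l l′

  IsLast-exists : x ∈ xs → T (f x) → ∃₂ λ y ys → IsLast f y ys xs
  IsLast-exists {xs = w ∷ ws} x∈ fx with Any.any? (T? ∘ f) ws
  ... | yes p with x′ , x′∈ , fx′ ← find p
                with y , ys , l ← IsLast-exists x′∈ fx′ = y , ys , skip l
  ... | no ¬p = w , ws , last (carrier x∈ fx) (T-not-any⁺ f ws ¬p)
    where
    carrier : ∀ {v} → v ∈ w ∷ ws → T (f v) → T (f w)
    carrier (here refl)  fv = fv
    carrier (there v∈ws) fv = ⊥-elim (¬p (lose v∈ws fv))

∈-[‥1]⁺ : ∀ {n j} → 1 ≤ j → j ≤ n → j ∈ [ n ‥1]
∈-[‥1]⁺ {j = suc j} _ j<n = ∈-map⁺ suc (∈-downFrom⁺ j<n)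

∈-[‥1]⇒≤ : ∀ {n j} → j ∈ [ n ‥1] → j ≤ n
∈-[‥1]⇒≤ j∈ with _ , v∈ , refl ← ∈-map⁻ suc j∈ = ∈-downFrom⁻ v∈

Before-[‥1] : ∀ {n i j} → i ∈ [ n ‥1] → j ∈ [ n ‥1] → i < j → Before [ n ‥1] j i
Before-[‥1] {suc n} (here refl) (here refl) i<j = ⊥-elim (<-irrefl refl i<j)
Before-[‥1] {suc n} (there i∈)  (here refl) _   = inj₁ (refl , i∈)
Before-[‥1] {suc n} (here refl) (there j∈)  i<j = ⊥-elim (<⇒≱ i<j (m≤n⇒m≤1+n (∈-[‥1]⇒≤ j∈)))
Before-[‥1] {suc n} (there i∈)  (there j∈)  i<j = inj₂ (Before-[‥1] i∈ j∈ i<j)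

module _ (n : ℕ) (ϱ : ℕ → Subset) where

  carries : ℕ → ℕ → Bool
  carries j w = inA n ϱ w j

  private
    fresh? : (w : ℕ) (ws : List ℕ) → Decidable λ j → T (carries j w ∧ not (any (carries j) ws))
    fresh? w ws j = T? (carries j w ∧ not (any (carries j) ws))

  ∈-μ⁺ : ∀ {j} w ws → 1 ≤ j → j ≤ n → T (carries j w) → T (not (any (carries j) ws)) → j ∈ μ n ϱ w ws
  ∈-μ⁺ w ws 1≤j j≤n cw none =
    ∈-filter⁺ (fresh? w ws) (∈-[‥1]⁺ 1≤j j≤n) (Equivalence.from T-∧ (cw , none))

  ∈-μ⁻ : ∀ {j} w ws → j ∈ μ n ϱ w ws → T (carries j w) × T (not (any (carries j) ws))
  ∈-μ⁻ w ws j∈ = Equivalence.to T-∧ (proj₂ (∈-filter⁻ (fresh? w ws) {xs = [ n ‥1]} j∈))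

  Before-μ : ∀ {i j} w ws → i < j → i ∈ μ n ϱ w ws → j ∈ μ n ϱ w ws → Before (μ n ϱ w ws) j i
  Before-μ w ws i<j i∈ j∈
    with i∈[n] , fresh-i ← ∈-filter⁻ (fresh? w ws) {xs = [ n ‥1]} i∈
       | j∈[n] , fresh-j ← ∈-filter⁻ (fresh? w ws) {xs = [ n ‥1]} j∈ =
    Before-filter⁺ (fresh? w ws) [ n ‥1] (Before-[‥1] i∈[n] j∈[n] i<j) fresh-j fresh-i

  Ω-∈⁺ : ∀ {j y ys ws} → 1 ≤ j → j ≤ n → IsLast (carries j) y ys ws → j ∈ Ω n ws ϱ
  Ω-∈⁺ {ws = w ∷ ws} 1≤j j≤n (last cy none) = ∈-++⁺ʳ (Ω n ws ϱ) (∈-μ⁺ w ws 1≤j j≤n cy none)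
  Ω-∈⁺ {ws = w ∷ ws} 1≤j j≤n (skip l)       = ∈-++⁺ˡ (Ω-∈⁺ 1≤j j≤n l)

  Ω-∈⁻ : ∀ {j} ws → j ∈ Ω n ws ϱ → ∃₂ λ y ys → IsLast (carries j) y ys ws
  Ω-∈⁻ (w ∷ ws) j∈ with ∈-++⁻ (Ω n ws ϱ) j∈
  ... | inj₁ j∈Ω with y , ys , l ← Ω-∈⁻ ws j∈Ω = y , ys , skip l
  ... | inj₂ j∈μ with cw , none ← ∈-μ⁻ w ws j∈μ = w , ws , last cw none

  Ω-Before⁻ : ∀ {i j} ws → Before (Ω n ws ϱ) j i →
              ∃₂ λ y ys → IsLast (carries j) y ys ws × T (not (any (carries i) ys))
  Ω-Before⁻ {i} (w ∷ ws) p with Before-++⁻ (Ω n ws ϱ) p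
  ... | inj₁ q with y , ys , l , none ← Ω-Before⁻ ws q = y , ys , skip l , none
  ... | inj₂ (inj₁ (j∈Ω , i∈μ)) with y , ys , l ← Ω-∈⁻ ws j∈Ω =
    y , ys , skip l , T-not-any⁺ (carries i) ys (T-not-any⁻ (proj₂ (∈-μ⁻ w ws i∈μ)) ∘ IsLast-suffix l)
  ... | inj₂ (inj₂ q) with j∈μ , i∈μ ← Before-∈ q with cw , none ← ∈-μ⁻ w ws j∈μ =
    w , ws , last cw none , proj₂ (∈-μ⁻ w ws i∈μ)

  Ω-Before⁺ : ∀ {i j x xs y ys ws} → 1 ≤ i → i < j → j ≤ n →
              IsLast (carries j) y ys ws → IsLast (carries i) x xs ws → T (not (any (carries i) ys)) →
              Before (Ω n ws ϱ) j i
  Ω-Before⁺ {ws = w ∷ ws} 1≤i i<j j≤n (last cj nj) (last ci ni) _ =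
    Before-++⁺ʳ (Ω n ws ϱ) (Before-μ w ws i<j (∈-μ⁺ w ws 1≤i i≤n ci ni) (∈-μ⁺ w ws 1≤j j≤n cj nj))
    where
    i≤n = <⇒≤ (<-≤-trans i<j j≤n)
    1≤j = <⇒≤ (≤-<-trans 1≤i i<j)
  Ω-Before⁺ {ws = w ∷ ws} _ _ _ (last _ _) (skip li) none =
    ⊥-elim (T-not-any⁻ none (lose (IsLast⇒∈ li) (IsLast⇒T li)))
  Ω-Before⁺ {ws = w ∷ ws} 1≤i i<j j≤n (skip lj) (last ci ni) _ =
    Before-++⁺ (Ω n ws ϱ) (Ω-∈⁺ 1≤j j≤n lj) (∈-μ⁺ w ws 1≤i i≤n ci ni)
    where
    i≤n = <⇒≤ (<-≤-trans i<j j≤n)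
    1≤j = <⇒≤ (≤-<-trans 1≤i i<j)
  Ω-Before⁺ {ws = w ∷ ws} 1≤i i<j j≤n (skip lj) (skip li) none =
    Before-++⁺ˡ (Ω n ws ϱ) (Ω-Before⁺ 1≤i i<j j≤n lj li none)

  Ω-inversion : ∀ {i j y ys x} ws → 1 ≤ i → i < j → j ≤ n →
                IsLast (carries j) y ys ws → x ∈ ws → T (carries i x) →
                Precedes (Ω n ws ϱ) j i ⇔ T (not (any (carries i) ys))
  Ω-inversion {i} {j} {y} {ys} ws 1≤i i<j j≤n lj x∈ cx = mk⇔ to from
    where
    to : Precedes (Ω n ws ϱ) j i → T (not (any (carries i) ys))
    to p with _ , _ , lj′ , none ← Ω-Before⁻ ws (Precedes⇒Before p) =
      subst (λ ys → T (not (any (carries i) ys))) (IsLast-unique lj′ lj) none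
    from : T (not (any (carries i) ys)) → Precedes (Ω n ws ϱ) j i
    from none with _ , _ , li ← IsLast-exists x∈ cx =
      Before⇒Precedes (Ω n ws ϱ) (Ω-Before⁺ 1≤i i<j j≤n lj li none)

module BroomOrder (k n : ℕ) where

  ≼⇒≤ : ∀ {x y} → (k , n) ⊢ x ≼ y → x ≤ y
  ≼⇒≤ ε                                = ≤-refl
  ≼⇒≤ ((_ , _ , inj₁ (_ , refl)) ◅ p)  = ≤-trans (n≤1+n _) (≼⇒≤ p)
  ≼⇒≤ ((_ , _ , inj₂ (lt , refl)) ◅ p) = ≤-trans (<⇒≤ lt) (≼⇒≤ p)

  bristle-≼⇒≡ : ∀ {x y} → n ∸ k < x → (k , n) ⊢ x ≼ y → y ≡ x
  bristle-≼⇒≡ _   ε                                  = refl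
  bristle-≼⇒≡ x>h ((_ , _ , inj₁ (sx≤h , refl)) ◅ _) = ⊥-elim (<-asym x>h sx≤h)
  bristle-≼⇒≡ x>h ((_ , _ , inj₂ (_ , refl)) ◅ _)    = ⊥-elim (<-irrefl refl x>h)

  handle-path : ∀ {x y} → 1 ≤ x → x ≤′ y → y ≤ n ∸ k → (k , n) ⊢ x ≼ y
  handle-path _   (≤′-reflexive refl) _    = ε
  handle-path 1≤x (≤′-step x≤′y)     sy≤h =
    handle-path 1≤x x≤′y (≤-trans (n≤1+n _) sy≤h)
      ◅◅ (≤-trans 1≤x (≤′⇒≤ x≤′y) , ≤-trans sy≤h (m∸n≤m n k) , inj₁ (sy≤h , refl)) ◅ ε

  handle-≼ : ∀ {x y} → 1 ≤ x → x ≤ n ∸ k → x < y → y ≤ n → (k , n) ⊢ x ≼ y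
  handle-≼ {y = y} 1≤x x≤h x<y y≤n with y ≤? n ∸ k
  ... | yes y≤h = handle-path 1≤x (≤⇒≤′ (<⇒≤ x<y)) y≤h
  ... | no  y≰h = handle-path 1≤x (≤⇒≤′ x≤h) ≤-refl
                  ◅◅ (≤-trans 1≤x x≤h , y≤n , inj₂ (≰⇒> y≰h , refl)) ◅ ε

  Ornamentation-⊆ : ∀ {ϱ a b} → Ornamentation k n ϱ → 1 ≤ a → a ≤ n → 1 ≤ b → b ≤ n →
                    b ∈ₛ ϱ a → ϱ b ⊆ₛ ϱ a
  Ornamentation-⊆ {ϱ} {a} {b} (orn , nested) 1≤a a≤n 1≤b b≤n b∈ϱa
    with _ , _ , a∈ϱa , hung-a ← orn a 1≤a a≤n | _ , _ , b∈ϱb , hung-b ← orn b 1≤b b≤n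
       | nested a b 1≤a a≤n 1≤b b≤n
  ... | inj₁ ϱa⊆ϱb       = subst (λ c → ϱ c ⊆ₛ ϱ a) (≤-antisym a≤b b≤a) λ _ u∈ → u∈
    where
    a≤b = ≼⇒≤ (hung-a b b∈ϱa)
    b≤a = ≼⇒≤ (hung-b a (ϱa⊆ϱb a a∈ϱa))
  ... | inj₂ (inj₁ ϱb⊆ϱa) = ϱb⊆ϱa
  ... | inj₂ (inj₂ disj)  = ⊥-elim (disj b b∈ϱa b∈ϱb)

module OrnamentedExtension (k n : ℕ) {lam ϱ} (θ : InΘ k n lam ϱ) where
  open BroomOrder k n

  private
    lam↭[1‥n] = proj₁ (proj₁ θ)
    ornamentation = proj₁ (proj₂ θ)

  lam-unique : Unique lam
  lam-unique = Unique-resp-↭ (setoid ℕ) (↭⇒↭ₛ (↭-sym lam↭[1‥n]))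
    (applyUpTo⁺₁ suc n (λ i<j _ → <⇒≢ i<j ∘ suc-injective))

  lam-∈ : ∀ {z} → 1 ≤ z → z ≤ n → z ∈ lam
  lam-∈ {suc z} _ z<n = ∈-resp-↭ (↭-sym lam↭[1‥n]) (∈-applyUpTo⁺ suc z<n)

  ϱ-root : ∀ {c} → 1 ≤ c → c ≤ n → c ∈ₛ ϱ c
  ϱ-root {c} 1≤c c≤n with _ , _ , c∈ϱc , _ ← proj₁ ornamentation c 1≤c c≤n = c∈ϱc

  ϱ-host : ∀ {c} → 1 ≤ c → c ≤ n → ∃₂ λ y ys → IsLast (ϱ c) y ys lam
  ϱ-host 1≤c c≤n = IsLast-exists (lam-∈ 1≤c c≤n) (ϱ-root 1≤c c≤n)

  ϱ-bristle : ∀ {c u} → n ∸ k < c → c ≤ n → u ∈ₛ ϱ c → u ≡ c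
  ϱ-bristle {c} {u} c>h c≤n u∈ with _ , _ , _ , hung ← proj₁ ornamentation c (≤-<-trans z≤n c>h) c≤n =
    bristle-≼⇒≡ c>h (hung u u∈)

  bristle-inversion : ∀ {a b y ys} → n ∸ k < a → a < b → b ≤ n → IsLast (ϱ a) y ys lam →
                      T (not (any (ϱ b) ys)) ⇔ Precedes lam b a
  bristle-inversion {a} {b} {y} {ys} a>h a<b b≤n l
    with refl ← ϱ-bristle a>h (<⇒≤ (<-≤-trans a<b b≤n)) (IsLast⇒T l) = mk⇔ to from
    where
    b>h = <-trans a>h a<b
    1≤b = ≤-<-trans z≤n b>h
    to : T (not (any (ϱ b) ys)) → Precedes lam b a
    to none with IsLast-∈ l (lam-∈ 1≤b b≤n)
    ... | inj₁ b<a         = Before⇒Precedes lam b<a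
    ... | inj₂ (inj₁ refl) = ⊥-elim (<-irrefl refl a<b)
    ... | inj₂ (inj₂ b∈ys) = ⊥-elim (T-not-any⁻ none (lose b∈ys (ϱ-root 1≤b b≤n)))
    later-b : Precedes lam b a → ¬ Any (T ∘ ϱ b) ys
    later-b b<a p with z , z∈ys , z∈ϱb ← find p with refl ← ϱ-bristle b>h b≤n z∈ϱb =
      Before-asym lam-unique (Precedes⇒Before b<a) (IsLast-Before l z∈ys)
    from : Precedes lam b a → T (not (any (ϱ b) ys))
    from b<a = T-not-any⁺ (ϱ b) ys (later-b b<a)

  handle-inversion : ∀ {a b y ys} → 1 ≤ a → a ≤ n ∸ k → a < b → b ≤ n → IsLast (ϱ a) y ys lam →
                     T (not (any (ϱ b) ys)) ⇔ b ∈ₛ ϱ a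
  handle-inversion {a} {b} {y} {ys} 1≤a a≤h a<b b≤n l = mk⇔ to from
    where
    a≤n = <⇒≤ (<-≤-trans a<b b≤n)
    1≤b = <⇒≤ (≤-<-trans 1≤a a<b)
    to : T (not (any (ϱ b) ys)) → b ∈ₛ ϱ a
    to none with IsLast-∈ l (lam-∈ 1≤b b≤n)
    ... | inj₂ (inj₁ refl) = IsLast⇒T l
    ... | inj₂ (inj₂ b∈ys) = ⊥-elim (T-not-any⁻ none (lose b∈ys (ϱ-root 1≤b b≤n)))
    ... | inj₁ b<y with ps , ms , qs , split , ms≈ϱa ← proj₂ (proj₂ θ) a 1≤a a≤n =
      Equivalence.from (ms≈ϱa b)
        (Before-convex lam ps ms qs split lam-unique a<b-in-lam b<y
          (Equivalence.to (ms≈ϱa a) (ϱ-root 1≤a a≤n)) (Equivalence.to (ms≈ϱa y) (IsLast⇒T l)))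
      where
      a<b-in-lam = Precedes⇒Before (proj₂ (proj₁ θ) a b (handle-≼ 1≤a a≤h a<b b≤n , <⇒≢ a<b))
    from : b ∈ₛ ϱ a → T (not (any (ϱ b) ys))
    from b∈ϱa = T-not-any⁺ (ϱ b) ys (T-not-any⁻ (IsLast⇒none l) ∘ Any.map (λ {u} → ϱb⊆ϱa u))
      where
      ϱb⊆ϱa = Ornamentation-⊆ ornamentation 1≤a a≤n 1≤b b≤n b∈ϱa

Inv⇔Precedes : ∀ {w i j} → i < j → Inv w i j ⇔ Precedes w j i
Inv⇔Precedes i<j = mk⇔ proj₂ (i<j ,_)

lemma7p3 : (k n : ℕ) → 1 ≤ k → k ≤ n →
    (i j : ℕ) → 1 ≤ i → i < j → j ≤ n →
    (lam : List ℕ) (ϱ : ℕ → Subset) → InΘ k n lam ϱ →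
      (j ≤ k → (Inv (Ω n lam ϱ) i j ⇔ Inv lam (suc n ∸ j) (suc n ∸ i)))
      × (k + 1 ≤ j → (Inv (Ω n lam ϱ) i j ⇔ (suc n ∸ i) ∈ₛ ϱ (suc n ∸ j)))
lemma7p3 k n _ k≤n (suc i) j 1≤i i<j j≤n lam ϱ θ = part₁ , part₂
  where
  open OrnamentedExtension k n θ
  a b : ℕ
  a = suc n ∸ j
  b = n ∸ i
  a<b : a < b
  a<b = ∸-monoʳ-< i<j (m≤n⇒m≤1+n j≤n)
  1≤a : 1 ≤ a
  1≤a = m<n⇒0<n∸m (s≤s j≤n)
  b≤n : b ≤ n
  b≤n = m∸n≤m n i
  host : ∃₂ λ y ys → IsLast (ϱ a) y ys lam
  host = ϱ-host 1≤a (<⇒≤ (<-≤-trans a<b b≤n))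
  inv : Inv (Ω n lam ϱ) (suc i) j ⇔ T (not (any (ϱ b) (proj₁ (proj₂ host))))
  inv = ⇔.trans (Inv⇔Precedes i<j) (Ω-inversion n ϱ lam 1≤i i<j j≤n (proj₂ (proj₂ host)) (lam-∈ 1≤b b≤n) (ϱ-root 1≤b b≤n))
    where 1≤b = <⇒≤ (≤-<-trans 1≤a a<b)
  part₁ : j ≤ k → Inv (Ω n lam ϱ) (suc i) j ⇔ Inv lam a b
  part₁ j≤k = ⇔.trans inv (⇔.trans (bristle-inversion a-bristle a<b b≤n (proj₂ (proj₂ host))) (⇔.sym (Inv⇔Precedes a<b)))
    where a-bristle = ∸-monoʳ-< (s≤s j≤k) (s≤s k≤n)
  part₂ : k + 1 ≤ j → Inv (Ω n lam ϱ) (suc i) j ⇔ b ∈ₛ ϱ a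
  part₂ k+1≤j = ⇔.trans inv (handle-inversion 1≤a a-handle a<b b≤n (proj₂ (proj₂ host)))
    where a-handle = ∸-monoʳ-≤ (suc n) (subst (_≤ j) (+-comm k 1) k+1≤j)
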